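{- Let $g$ be a convex geometry on a finite set $I$, $n\in\mathbb N$, and $f:I\to[n]$. Then $f$ is extremal if and only if $f$ is convex, and $f$ is strictly extremal if and only if $f$ is strictly convex.
   Context: A convex geometry on finite $I$ is $g:2^I\to2^I$ with $A\subseteq g(A)$, $g(g(A))=g(A)$, monotone, $g(\emptyset)=\emptyset$, and anti-exchange (if $a\ne b$, $a,b\notin g(A)$, $a\in g(A\cup\{b\})$ then $b\notin g(A\cup\{a\})$). Convex sets: $g(K)=K$. For convex $K$, $\mathrm{Ex}(K)=\{a\in K: K\setminus\{a\}\text{ convex}\}$. For convex $A\subseteq B$, the minor $g_{A:B}$ on $B\setminus A$ is $g_{A:B}(X)=g(A\cup X)\cap(B\setminus A)$; it is discrete if $g_{A:B}(X)=X$ for all $X\subseteq B\setminus A$. For nonempty convex $K$, $f^K=\max_{x\in K}f(x)$. $f$ is extremal if for every nonempty convex $K$, $\{x\in K:f(x)=f^K\}\cap\mathrm{Ex}(K)\ne\emptyset$; strictly extremal if for every nonempty convex $K$, $\{x\in K:f(x)=f^K\}\subseteq\mathrm{Ex}(K)$. $f$ is convex if $f^{ -1}([m])$ is convex in $g$ for every $0\le m\le n$ (where $[m]=\{1,\dots,m\}$, $[0]=\emptyset$); $f$ is strictly convex if it is convex and $g_{f^{ -1}([i]):f^{ -1}([i+1])}$ is discrete for every $0\le i\le n-1$. -}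

module Defs where

open import Data.Nat using (ℕ; suc; _≤_; _<_; _≤?_)
open import Data.Fin using (Fin)
open import Data.Fin.Subset using (Subset; _∈_; _∉_; _⊆_; _∪_; _∩_; _─_; _-_; ⁅_⁆; ⊥; Nonempty)
open import Data.Vec using (tabulate)
open import Data.Product using (_×_; ∃)
open import Relation.Binary.PropositionalEquality using (_≡_; _≢_)
open import Relation.Nullary.Decidable using (⌊_⌋)

record IsConvexGeometry {k : ℕ} (g : Subset k → Subset k) : Set where
  field
    extensive    : ∀ A → A ⊆ g A
    idempotent   : ∀ A → g (g A) ≡ g A
    monotone     : ∀ {A B} → A ⊆ B → g A ⊆ g B
    empty        : g ⊥ ≡ ⊥
    antiExchange : ∀ A a b → a ≢ b → a ∉ g A → b ∉ g A →
                   a ∈ g (A ∪ ⁅ b ⁆) → b ∉ g (A ∪ ⁅ a ⁆)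

module _ {k : ℕ} (g : Subset k → Subset k) where

  IsConvex : Subset k → Set
  IsConvex K = g K ≡ K

  IsExtreme : Subset k → Fin k → Set
  IsExtreme K a = a ∈ K × IsConvex (K - a)

  MinorDiscrete : Subset k → Subset k → Set
  MinorDiscrete A B = ∀ X → X ⊆ (B ─ A) → (g (A ∪ X) ∩ (B ─ A)) ≡ X

  module _ (n : ℕ) (f : Fin k → ℕ) where

    AttainsMax : Subset k → Fin k → Set
    AttainsMax K x = x ∈ K × (∀ y → y ∈ K → f y ≤ f x)

    Extremal : Set
    Extremal = ∀ K → IsConvex K → Nonempty K →
               ∃ λ x → AttainsMax K x × IsExtreme K x

    StrictlyExtremal : Set
    StrictlyExtremal = ∀ K → IsConvex K → Nonempty K →
                       ∀ x → AttainsMax K x → IsExtreme K x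

    -- f⁻¹([m]) = { x | f x ≤ m }   ([m] = {1,…,m}, values of f lie in [n])
    preimage : ℕ → Subset k
    preimage m = tabulate (λ x → ⌊ f x ≤? m ⌋)

    ConvexFn : Set
    ConvexFn = ∀ m → m ≤ n → IsConvex (preimage m)

    StrictlyConvexFn : Set
    StrictlyConvexFn = ConvexFn ×
      (∀ i → i < n → MinorDiscrete (preimage i) (preimage (suc i)))

-- If f is
-- extremal, an extreme maximiser of f on the hull g(f⁻¹([m])) lies in
-- f⁻¹([m]) itself (extreme points of a hull lie in its generators), so the
-- hull stays below m.  Conversely, for convex K with maximum f^K = i + 1 the
-- set K ∩ f⁻¹([i]) is a proper convex subset, and a convex geometry always
-- has an extreme point of K outside any proper convex subset; such a point
-- attains f^K.  The strict versions follow the same pattern, with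
-- discreteness of the minor g_{f⁻¹([i]) : f⁻¹([i+1])} exactly matching the
-- requirement that every maximiser on a convex set be extreme.
module Submission where

open import Defs

open import Data.Bool using (true; false)
open import Data.Bool.Properties using (T-≡)
open import Data.Empty using (⊥-elim)
open import Data.Fin using (Fin; zero; suc; _≟_)
open import Data.Fin.Properties using (any?)
open import Data.Fin.Subset
  using (Subset; _∈_; _∉_; _⊆_; _⊂_; _⊃_; _∪_; _∩_; _─_; _-_; ⁅_⁆; Nonempty)
open import Data.Fin.Subset.Induction using (Acc; acc; ⊃-wellFounded)
open import Data.Fin.Subset.Properties
  using ( _∈?_; nonempty?; _⊆?_; ⊆-antisym; x∈p∩q⁺; x∈p∩q⁻; p∩q⊆p; p∩q⊆q; x∈p∪q⁺
        ; x∈p∪q⁻; p⊆p∪q; q⊆p∪q; p─q⊆p; x∈p∧x∉q⇒x∈p─q; x∈p∧x≢y⇒x∈p-y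
        ; x∈⁅x⁆; x∈⁅y⁆⇒x≡y)
open import Data.Nat using (ℕ; zero; suc; _≤_; _<_; _≤?_; s≤s; z≤n)
open import Data.Nat.Properties using (≤-refl; ≤-trans; <⇒≤; <⇒≱; ≰⇒>; m≤n⇒m≤1+n)
open import Data.Product using (_×_; ∃; _,_; proj₁; proj₂)
open import Data.Sum using ([_,_]; inj₁; inj₂)
open import Data.Vec using (_∷_; there)
open import Data.Vec.Properties using (lookup∘tabulate; []=⇒lookup; lookup⇒[]=)
open import Function using (_∘_; id)
open import Function.Bundles using (_⇔_; mk⇔; Equivalence)
open import Relation.Nullary using (¬_; yes; no)
open import Relation.Nullary.Decidable using (_×-dec_; ¬?; fromWitness; toWitness; decidable-stable)
open import Relation.Unary using (Pred; Decidable)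
open import Relation.Binary.PropositionalEquality using (_≡_; _≢_; refl; sym; trans; subst)

private
  variable
    k m n : ℕ
    x y : Fin k
    p q r : Subset k

x∈p─q⇒x∉q : ∀ (p q : Subset k) → x ∈ p ─ q → x ∉ q
x∈p─q⇒x∉q {x = zero}  (_ ∷ p) (true ∷ q) ()
x∈p─q⇒x∉q {x = zero}  (_ ∷ p) (false ∷ q) _ ()
x∈p─q⇒x∉q {x = suc x} (_ ∷ p) (_ ∷ q) (there x∈) (there x∈q) = x∈p─q⇒x∉q p q x∈ x∈q

x∈p-y⇒x≢y : ∀ (p : Subset k) → x ∈ p - y → x ≢ y
x∈p-y⇒x≢y {y = y} p x∈ refl = x∈p─q⇒x∉q p ⁅ y ⁆ x∈ (x∈⁅x⁆ y)

∪-least : p ⊆ r → q ⊆ r → p ∪ q ⊆ r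
∪-least {p = p} {q = q} p⊆r q⊆r x∈ = [ p⊆r , q⊆r ] (x∈p∪q⁻ p q x∈)

x∈p⇒⁅x⁆⊆p : x ∈ p → ⁅ x ⁆ ⊆ p
x∈p⇒⁅x⁆⊆p {x = x} {p = p} x∈p y∈ = subst (_∈ p) (sym (x∈⁅y⁆⇒x≡y x y∈)) x∈p

⊈⇒∃ : ¬ p ⊆ q → ∃ λ x → x ∈ p × x ∉ q
⊈⇒∃ {p = p} {q = q} p⊈q with any? (λ x → x ∈? p ×-dec ¬? (x ∈? q))
... | yes witness = witness
... | no none     = ⊥-elim (p⊈q λ {x} x∈p → decidable-stable (x ∈? q) (λ x∉q → none (x , x∈p , x∉q)))

argmax : ∀ {ℓ} {P : Pred (Fin k) ℓ} → Decidable P → (h : Fin k → ℕ) → ∃ P →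
         ∃ λ x → P x × (∀ y → P y → h y ≤ h x)
argmax {zero}  P? h (() , _)
argmax {suc k} P? h (x₀ , Px₀) with any? (P? ∘ suc)
... | no none with x₀
...   | zero  = zero , Px₀ , λ { zero _ → ≤-refl ; (suc y) Py → ⊥-elim (none (y , Py)) }
...   | suc x = ⊥-elim (none (x , Px₀))
argmax {suc k} P? h (x₀ , Px₀) | yes some with argmax (P? ∘ suc) (h ∘ suc) some
... | x , Px , max with P? zero
...   | no ¬P0 = suc x , Px , λ { zero P0 → ⊥-elim (¬P0 P0) ; (suc y) Py → max y Py }
...   | yes P0 with h zero ≤? h (suc x)
...     | yes h0≤ = suc x , Px , λ { zero _ → h0≤ ; (suc y) Py → max y Py }
...     | no h0≰  = zero , P0 , λ { zero _ → ≤-refl ; (suc y) Py → ≤-trans (max y Py) (<⇒≤ (≰⇒> h0≰)) }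

1≤m≤n⇒pred : 1 ≤ m → m ≤ n → ∃ λ i → suc i ≡ m × i < n
1≤m≤n⇒pred {m = suc i} (s≤s z≤n) m≤n = i , refl , m≤n

module ConvexGeometryProperties {g : Subset k → Subset k} (cg : IsConvexGeometry g) where
  open IsConvexGeometry cg

  closure-least : IsConvex g r → p ⊆ r → g p ⊆ r
  closure-least {r = r} r-convex p⊆r x∈ = subst (_ ∈_) r-convex (monotone p⊆r x∈)

  ∩-convex : IsConvex g p → IsConvex g q → IsConvex g (p ∩ q)
  ∩-convex {p = p} {q = q} p-convex q-convex = ⊆-antisym
    (λ x∈ → x∈p∩q⁺ (closure-least p-convex (p∩q⊆p p q) x∈ , closure-least q-convex (p∩q⊆q p q) x∈))
    (extensive _)

  extreme-closure⇒∈ : IsExtreme g (g p) x → x ∈ p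
  extreme-closure⇒∈ {p = p} {x = x} (x∈gp , gp-x-convex) with x ∈? p
  ... | yes x∈p = x∈p
  ... | no  x∉p = ⊥-elim (x∈p-y⇒x≢y (g p) (closure-least gp-x-convex p⊆gp-x x∈gp) refl)
    where
    p⊆gp-x : p ⊆ g p - x
    p⊆gp-x y∈p = x∈p∧x≢y⇒x∈p-y (extensive p y∈p) λ { refl → x∉p y∈p }

  mutually-generated⇒≡ : IsConvex g p → x ∉ p → y ∉ p →
                         x ∈ g (p ∪ ⁅ y ⁆) → y ∈ g (p ∪ ⁅ x ⁆) → x ≡ y
  mutually-generated⇒≡ {p = p} {x = x} {y = y} p-convex x∉p y∉p x∈ y∈ with x ≟ y
  ... | yes x≡y = x≡y
  ... | no  x≢y = ⊥-elim (antiExchange _ x y x≢y (∉closure x∉p) (∉closure y∉p) x∈ y∈)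
    where
    ∉closure : ∀ {z} → z ∉ p → z ∉ g p
    ∉closure z∉p z∈ = z∉p (subst (_ ∈_) p-convex z∈)

  -- Grow M to g(M ∪ ⁅ b ⁆) while that stays a proper subset of K.  Once every
  -- b ∈ K ─ M generates K over M, anti-exchange leaves a as the only such b,
  -- so K - a = M is convex.
  extreme-outside : IsConvex g r → IsConvex g p → p ⊂ r → ∃ λ x → x ∉ p × IsExtreme g r x
  extreme-outside {r = K} K-convex p-convex p⊂K = go (⊃-wellFounded _) p-convex p⊂K
    where
    go : ∀ {M} → Acc _⊃_ M → IsConvex g M → M ⊂ K → ∃ λ x → x ∉ M × IsExtreme g K x
    go {M} (acc rec) M-convex (M⊆K , a , a∈K , a∉M)
      with any? (λ b → b ∈? K ×-dec ¬? (b ∈? M) ×-dec ¬? (K ⊆? g (M ∪ ⁅ b ⁆)))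
    ... | yes (b , b∈K , b∉M , K⊈Mb) with go (rec M⊂Mb) (idempotent _) Mb⊂K
      where
      M⊆Mb : M ⊆ g (M ∪ ⁅ b ⁆)
      M⊆Mb = extensive _ ∘ p⊆p∪q _
      M⊂Mb : M ⊂ g (M ∪ ⁅ b ⁆)
      M⊂Mb = M⊆Mb , b , extensive _ (q⊆p∪q M _ (x∈⁅x⁆ b)) , b∉M
      Mb⊂K : g (M ∪ ⁅ b ⁆) ⊂ K
      Mb⊂K = closure-least K-convex (∪-least M⊆K (x∈p⇒⁅x⁆⊆p b∈K)) , ⊈⇒∃ K⊈Mb
    ...   | x , x∉Mb , x-extreme = x , x∉Mb ∘ extensive _ ∘ p⊆p∪q _ , x-extreme
    go {M} _ M-convex (M⊆K , a , a∈K , a∉M) | no none =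
      a , a∉M , a∈K , subst (λ Z → g Z ≡ Z) (sym K-a≡M) M-convex
      where
      generates : ∀ {b} → b ∈ K → b ∉ M → K ⊆ g (M ∪ ⁅ b ⁆)
      generates b∈K b∉M = decidable-stable (K ⊆? _) λ K⊈ → none (_ , b∈K , b∉M , K⊈)

      K-a⊆M : K - a ⊆ M
      K-a⊆M {x} x∈ with x ∈? M
      ... | yes x∈M = x∈M
      ... | no  x∉M = ⊥-elim (x∈p-y⇒x≢y K x∈ (mutually-generated⇒≡ M-convex x∉M a∉M
                        (generates a∈K a∉M x∈K) (generates x∈K x∉M a∈K)))
        where x∈K = p─q⊆p K ⁅ a ⁆ x∈

      K-a≡M : K - a ≡ M
      K-a≡M = ⊆-antisym K-a⊆M λ x∈M → x∈p∧x≢y⇒x∈p-y (M⊆K x∈M) λ { refl → a∉M x∈M }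

module Sublevels (g : Subset k → Subset k) (n : ℕ) (f : Fin k → ℕ) where

  sublevel : ℕ → Subset k
  sublevel = preimage g n f

  ∈-sublevel⁺ : f x ≤ m → x ∈ sublevel m
  ∈-sublevel⁺ {x = x} {m = m} fx≤m =
    lookup⇒[]= x _ (trans (lookup∘tabulate _ x) (Equivalence.to T-≡ (fromWitness fx≤m)))

  ∈-sublevel⁻ : x ∈ sublevel m → f x ≤ m
  ∈-sublevel⁻ {x = x} x∈ =
    toWitness (Equivalence.from T-≡ (trans (sym (lookup∘tabulate _ x)) ([]=⇒lookup x∈)))

  ∉-sublevel⁺ : m < f x → x ∉ sublevel m
  ∉-sublevel⁺ m<fx = <⇒≱ m<fx ∘ ∈-sublevel⁻

  ∉-sublevel⁻ : x ∉ sublevel m → m < f x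
  ∉-sublevel⁻ x∉ = ≰⇒> (x∉ ∘ ∈-sublevel⁺)

module Characterisation {g : Subset k → Subset k} (cg : IsConvexGeometry g)
                        (n : ℕ) (f : Fin k → ℕ) where
  open IsConvexGeometry cg
  open ConvexGeometryProperties cg
  open Sublevels g n f

  Bounded : Set
  Bounded = ∀ x → 1 ≤ f x × f x ≤ n

  maximiser : ∀ K → Nonempty K → ∃ (AttainsMax g n f K)
  maximiser K = argmax (_∈? K) f

  extremal⇒convex : Extremal g n f → ConvexFn g n f
  extremal⇒convex extremal m _ with nonempty? (g (sublevel m))
  ... | no empty = ⊆-antisym (λ x∈ → ⊥-elim (empty (_ , x∈))) (extensive _)
  ... | yes nonempty with extremal (g (sublevel m)) (idempotent _) nonempty
  ...   | x , (_ , x-max) , x-extreme = ⊆-antisym hull⊆sublevel (extensive _)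
    where
    hull⊆sublevel : g (sublevel m) ⊆ sublevel m
    hull⊆sublevel {y} y∈ =
      ∈-sublevel⁺ (≤-trans (x-max y y∈) (∈-sublevel⁻ (extreme-closure⇒∈ x-extreme)))

  convex⇒extremal : Bounded → ConvexFn g n f → Extremal g n f
  convex⇒extremal bounded convex K K-convex nonempty with maximiser K nonempty
  ... | x , x∈K , x-max with 1≤m≤n⇒pred (proj₁ (bounded x)) (proj₂ (bounded x))
  ...   | i , 1+i≡fx , i<n with extreme-outside K-convex lower-convex lower⊂K
    where
    lower-convex : IsConvex g (K ∩ sublevel i)
    lower-convex = ∩-convex K-convex (convex i (<⇒≤ i<n))
    lower⊂K : K ∩ sublevel i ⊂ K
    lower⊂K = p∩q⊆p K _ , x , x∈K , ∉-sublevel⁺ (subst (i <_) 1+i≡fx ≤-refl) ∘ p∩q⊆q K _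
  ...     | a , a∉lower , a-extreme@(a∈K , _) = a , (a∈K , a-max) , a-extreme
    where
    a-max : ∀ y → y ∈ K → f y ≤ f a
    a-max y y∈K = ≤-trans (x-max y y∈K)
      (subst (_≤ f a) 1+i≡fx (∉-sublevel⁻ λ a∈ → a∉lower (x∈p∩q⁺ (a∈K , a∈))))

  strictlyExtremal⇒extremal : StrictlyExtremal g n f → Extremal g n f
  strictlyExtremal⇒extremal strictlyExtremal K K-convex nonempty with maximiser K nonempty
  ... | x , x-max = x , x-max , strictlyExtremal K K-convex nonempty x x-max

  strictlyExtremal⇒strictlyConvex : StrictlyExtremal g n f → StrictlyConvexFn g n f
  strictlyExtremal⇒strictlyConvex strictlyExtremal = convex , discrete
    where
    convex : ConvexFn g n f
    convex = extremal⇒convex (strictlyExtremal⇒extremal strictlyExtremal)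

    discrete : ∀ i → i < n → MinorDiscrete g (sublevel i) (sublevel (suc i))
    discrete i i<n X X⊆B─A = ⊆-antisym minor⊆X
      (λ x∈X → x∈p∩q⁺ (extensive _ (q⊆p∪q A X x∈X) , X⊆B─A x∈X))
      where
      A = sublevel i
      B = sublevel (suc i)

      hull⊆B : g (A ∪ X) ⊆ B
      hull⊆B = closure-least (convex (suc i) i<n)
        (∪-least (∈-sublevel⁺ ∘ m≤n⇒m≤1+n ∘ ∈-sublevel⁻) (p─q⊆p B A ∘ X⊆B─A))

      minor⊆X : g (A ∪ X) ∩ (B ─ A) ⊆ X
      minor⊆X {y} y∈ with x∈p∩q⁻ (g (A ∪ X)) (B ─ A) y∈
      ... | y∈hull , y∈B─A =
        [ ⊥-elim ∘ x∈p─q⇒x∉q B A y∈B─A , id ] (x∈p∪q⁻ A X (extreme-closure⇒∈ y-extreme))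
        where
        y-max : ∀ z → z ∈ g (A ∪ X) → f z ≤ f y
        y-max z z∈ = ≤-trans (∈-sublevel⁻ (hull⊆B z∈)) (∉-sublevel⁻ (x∈p─q⇒x∉q B A y∈B─A))
        y-extreme : IsExtreme g (g (A ∪ X)) y
        y-extreme = strictlyExtremal _ (idempotent _) (y , y∈hull) y (y∈hull , y-max)

  strictlyConvex⇒strictlyExtremal : Bounded → StrictlyConvexFn g n f → StrictlyExtremal g n f
  strictlyConvex⇒strictlyExtremal bounded (_ , discrete) K K-convex _ x (x∈K , x-max)
    with 1≤m≤n⇒pred (proj₁ (bounded x)) (proj₂ (bounded x))
  ... | i , 1+i≡fx , i<n = x∈K , ⊆-antisym hull⊆K-x (extensive _)
    where
    A = sublevel i
    B = sublevel (suc i)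
    X = (K - x) ∩ (B ─ A)

    x∉A : x ∉ A
    x∉A = ∉-sublevel⁺ (subst (i <_) 1+i≡fx ≤-refl)

    ∈-top-layer : ∀ {z} → z ∈ K → z ∉ A → z ∈ B ─ A
    ∈-top-layer {z} z∈K z∉A = x∈p∧x∉q⇒x∈p─q (∈-sublevel⁺ (subst (f z ≤_) (sym 1+i≡fx) (x-max z z∈K))) z∉A

    K-x⊆A∪X : K - x ⊆ A ∪ X
    K-x⊆A∪X {z} z∈ with z ∈? A
    ... | yes z∈A = x∈p∪q⁺ (inj₁ z∈A)
    ... | no  z∉A = x∈p∪q⁺ (inj₂ (x∈p∩q⁺ (z∈ , ∈-top-layer (p─q⊆p K _ z∈) z∉A)))

    hull⊆K : g (K - x) ⊆ K
    hull⊆K = closure-least K-convex (p─q⊆p K _)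

    -- A point of g(K - x) above level i lies in g(A ∪ X) ∩ (B ─ A), which is X
    -- by discreteness of the minor.
    hull⊆K-x : g (K - x) ⊆ K - x
    hull⊆K-x {z} z∈ with z ∈? A
    ... | yes z∈A = x∈p∧x≢y⇒x∈p-y (hull⊆K z∈) λ { refl → x∉A z∈A }
    ... | no  z∉A = p∩q⊆p (K - x) (B ─ A)
      (subst (z ∈_) (discrete i i<n X (p∩q⊆q (K - x) (B ─ A)))
        (x∈p∩q⁺ (monotone K-x⊆A∪X z∈ , ∈-top-layer (hull⊆K z∈) z∉A)))

mainTheorem10 : (k : ℕ) (g : Subset k → Subset k) → IsConvexGeometry g →
    (n : ℕ) (f : Fin k → ℕ) → (∀ x → 1 ≤ f x × f x ≤ n) →
    (Extremal g n f ⇔ ConvexFn g n f) × (StrictlyExtremal g n f ⇔ StrictlyConvexFn g n f)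
mainTheorem10 k g cg n f bounded =
    mk⇔ extremal⇒convex (convex⇒extremal bounded)
  , mk⇔ strictlyExtremal⇒strictlyConvex (strictlyConvex⇒strictlyExtremal bounded)
  where open Characterisation cg n f
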